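{- Let $\mathcal Q$ be a set of generalized quantifiers of type $(1)$ and $Q$ a generalized quantifier of type $(1)$ (no monotonicity assumed). Let $\hat E(Q)$ be the team quantifier defined, for all structures $M$ and teams $X$ on $M$, by $$\hat E(Q)^{M,X}=\{\mathfrak F\subseteq\wp(M)^X : \exists F\in\mathfrak F\ \forall s\in X\ (F(s)\in Q^M)\}.$$ Then for every structure $M$, every team $X$ on $M$ suitable for $\psi$, and every formula $\psi$ of $IF(\mathcal Q\cup\{Q\})$, $$M,X\models\psi\iff M,X\models\psi^*,$$ where $\psi^*$ is the $IF(\mathcal Q)[\hat E(Q)]$ formula obtained from $\psi$ by replacing every occurrence of the quantifier symbol $Q$ by $\hat E(Q)$. The same holds for formulas of $DF(\mathcal Q\cup\{Q\})$ (backslashed quantifiers), and for formulas containing both slashed and backslashed quantifiers.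
   Context: A generalized quantifier of type $(1)$ is a class $Q$ of structures $(M,S)$ with $S$ unary; $Q^M=\{S\subseteq M:(M,S)\in Q\}$. Assignments: functions from finite sets of variables to $M$; $s(a/v)$ sends $v$ to $a$. A team $X$ is a set of assignments with common domain $dom(X)$; $s\sim_W s'$ means $s,s'$ agree outside $W$; $F:X\to\wp(M)$ is $W$-uniform if $s\sim_W s'$ implies $F(s)=F(s')$. $X[F/v]=\{s(a/v):s\in X,a\in F(s)\}$, $X[M/v]=\{s(a/v):s\in X,a\in M\}$. $\wp(M)^X$ denotes the set of all functions $X\to\wp(M)$. Formulas are built from atomic $\alpha$, $\neg\alpha$, $\land$, $\lor$ and quantifiers $(\mathsf Qv/V)$ (slashed) or $(\mathsf Qv\backslash V)$ (backslashed), $V$ a finite set of variables. Semantics: atoms/negated atoms hold iff every $s\in X$ satisfies them in the Tarskian sense; $\land$ componentwise; $M,X\models\psi\lor\chi$ iff $X=Y\cup Z$ with $M,Y\models\psi$, $M,Z\models\chi$; $(\forall v/V)\psi$ and $(\forall v\backslash V)\psi$ hold iff $M,X[M/v]\models\psi$; $(\exists v/V)\psi$ holds iff $M,X[F/v]\models\psi$ for a $V$-uniform $F:X\to\wp(M)\setminus\{\emptyset\}$; $(Q v/V)\psi$ (for a generalized quantifier $Q$) holds iff $M,X[F/v]\models\psi$ for a $V$-uniform $F:X\to Q^M$; backslashed versions are the same with "$V$-uniform" replaced by "$(dom(X)\setminus V)$-uniform". A team quantifier $\hat Q$ assigns to each structure $M$ and team $X$ on $M$ a set $\hat Q^{M,X}\subseteq\wp(\wp(M)^X)$.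 For a formula $\psi$, let $[\psi]^{v,V}_{M,X}=\{F:X\to\wp(M)\mid F\text{ is }V\text{ -uniform and }M,X[F/v]\models\psi\}$ (for backslashed quantifiers use $(dom(X)\setminus V)$-uniform functions instead). The language $IF(\mathcal Q)[\hat Q]$ adds formulas $(\hat Qv/V)\psi$ with semantics $M,X\models(\hat Qv/V)\psi$ iff $[\psi]^{v,V}_{M,X}\in\hat Q^{M,X}$ (and analogously for $(\hat Qv\backslash V)\psi$). -}

module Defs where

open import Data.Nat using (ℕ; _≟_)
open import Data.Fin using (Fin)
open import Data.List using (List; _∷_)
open import Data.List.Membership.Propositional using (_∈_; _∉_)
open import Data.Maybe using (Maybe; just; nothing; maybe)
open import Data.Product using (Σ; Σ-syntax; ∃; _×_; _,_)
open import Data.Sum using (_⊎_)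
open import Data.Empty using (⊥; ⊥-elim)
open import Data.Unit using (⊤; tt)
open import Relation.Nullary using (¬_; yes; no)
open import Level using (Lift; suc; zero)
open import Relation.Binary.PropositionalEquality using (_≡_; _≢_)

record Signature : Set₁ where
  field
    RelSym : Set
    arity  : RelSym → ℕ
open Signature public

record Structure (Sig : Signature) : Set₁ where
  field
    Carrier : Set
    relI    : (R : RelSym Sig) → (Fin (arity Sig R) → Carrier) → Set
open Structure public

GQ : Set₁
GQ = (A : Set) → (A → Set) → Set

Var : Set
Var = ℕ

-- an assignment is a partial function Var ⇀ M (finite domain is
-- ensured by 'HasDom' below)
Assign : Set → Set
Assign A = Var → Maybe A

HasDom : {A : Set} → List Var → Assign A → Set
HasDom D s = ∀ w → (w ∈ D → ∃ λ a → s w ≡ just a) × (w ∉ D → s w ≡ nothing)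

IsTeam : {A : Set} → List Var → (Assign A → Set) → Set
IsTeam D X = ∀ s → X s → HasDom D s

upd : {A : Set} → Assign A → Var → A → Assign A
upd s v a w with w ≟ v
... | yes _ = just a
... | no  _ = s w

extend : {A : Set} → (Assign A → Set) → (Assign A → A → Set) → Var → Assign A → Set
extend {A} X F v t =
  Σ[ s ∈ Assign A ] X s × Σ[ a ∈ A ] F s a × (∀ w → t w ≡ upd s v a w)

extendAll : {A : Set} → (Assign A → Set) → Var → Assign A → Set
extendAll {A} X v t =
  Σ[ s ∈ Assign A ] X s × Σ[ a ∈ A ] (∀ w → t w ≡ upd s v a w)

data Mode : Set where
  slash backslash : Mode

-- s ~_W s' where W = V (slashed) or W = dom(X) \ V (backslashed)
Agree : {A : Set} → Mode → (D V : List Var) → Assign A → Assign A → Set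
Agree slash     D V s s' = ∀ w → w ∉ V → s w ≡ s' w
Agree backslash D V s s' = ∀ w → ¬ (w ∈ D × w ∉ V) → s w ≡ s' w

SameSet : {A : Set} → (A → Set) → (A → Set) → Set
SameSet P P' = ∀ a → (P a → P' a) × (P' a → P a)

Uniform : {A : Set} → Mode → (D V : List Var) → (Assign A → Set) →
          (Assign A → A → Set) → Set
Uniform m D V X F =
  ∀ s s' → X s → X s' → Agree m D V s s' → SameSet (F s) (F s')

TeamQuant : (Sig : Signature) → Set₂
TeamQuant Sig = (𝔐 : Structure Sig) → (D : List Var) →
  (Assign (Carrier 𝔐) → Set) →
  ((Assign (Carrier 𝔐) → Carrier 𝔐 → Set) → Set₁) → Set₁

EHat : {Sig : Signature} → GQ → TeamQuant Sig
EHat Q 𝔐 D X 𝔉 =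
  Σ[ F ∈ (Assign (Carrier 𝔐) → Carrier 𝔐 → Set) ]
    𝔉 F × (∀ s → X s → Q (Carrier 𝔐) (F s))

-- Syntax: S = generalized quantifier symbols, T = team quantifier symbols

data Atom (Sig : Signature) : Set where
  rel : (R : RelSym Sig) → (Fin (arity Sig R) → Var) → Atom Sig
  eq  : Var → Var → Atom Sig

data Form (Sig : Signature) (S T : Set) : Set where
  atom : Atom Sig → Form Sig S T
  neg  : Atom Sig → Form Sig S T
  and  : Form Sig S T → Form Sig S T → Form Sig S T
  or   : Form Sig S T → Form Sig S T → Form Sig S T
  all  : Mode → Var → List Var → Form Sig S T → Form Sig S T
  ex   : Mode → Var → List Var → Form Sig S T → Form Sig S T
  gq   : S → Mode → Var → List Var → Form Sig S T → Form Sig S T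
  tq   : T → Mode → Var → List Var → Form Sig S T → Form Sig S T

-- free variables (the slash sets V are not counted)
Free : {Sig : Signature} {S T : Set} → Form Sig S T → Var → Set
Free (atom (rel R xs)) w = ∃ λ i → xs i ≡ w
Free (atom (eq x y))   w = (x ≡ w) ⊎ (y ≡ w)
Free (neg (rel R xs))  w = ∃ λ i → xs i ≡ w
Free (neg (eq x y))    w = (x ≡ w) ⊎ (y ≡ w)
Free (and φ ψ)         w = Free φ w ⊎ Free ψ w
Free (or φ ψ)          w = Free φ w ⊎ Free ψ w
Free (all m v V φ)     w = w ≢ v × Free φ w
Free (ex m v V φ)      w = w ≢ v × Free φ w
Free (gq _ m v V φ)    w = w ≢ v × Free φ w
Free (tq _ m v V φ)    w = w ≢ v × Free φ w

Suitable : {Sig : Signature} {S T : Set} → List Var → Form Sig S T → Set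
Suitable D φ = ∀ w → Free φ w → w ∈ D

TarskiAtom : {Sig : Signature} (𝔐 : Structure Sig) → Atom Sig →
             Assign (Carrier 𝔐) → Set
TarskiAtom {Sig} 𝔐 (rel R xs) s =
  Σ[ as ∈ (Fin (arity Sig R) → Carrier 𝔐) ] (∀ i → s (xs i) ≡ just (as i)) × relI 𝔐 R as
TarskiAtom 𝔐 (eq x y) s =
  Σ[ a ∈ Carrier 𝔐 ] (s x ≡ just a) × (s y ≡ just a)

TarskiNegAtom : {Sig : Signature} (𝔐 : Structure Sig) → Atom Sig →
                Assign (Carrier 𝔐) → Set
TarskiNegAtom {Sig} 𝔐 (rel R xs) s =
  Σ[ as ∈ (Fin (arity Sig R) → Carrier 𝔐) ] (∀ i → s (xs i) ≡ just (as i)) × ¬ relI 𝔐 R as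
TarskiNegAtom 𝔐 (eq x y) s =
  Σ[ a ∈ Carrier 𝔐 ] Σ[ b ∈ Carrier 𝔐 ] (s x ≡ just a) × (s y ≡ just b) × a ≢ b

module _ {Sig : Signature} {S T : Set} (gqI : S → GQ) (tqI : T → TeamQuant Sig)
         (𝔐 : Structure Sig) where

  private
    M = Carrier 𝔐

  Sat : List Var → (Assign M → Set) → Form Sig S T → Set₁

  Interp : Mode → List Var → (Assign M → Set) → Var → List Var →
           Form Sig S T → (Assign M → M → Set) → Set₁
  Interp m D X v V ψ F = Uniform m D V X F × Sat (v ∷ D) (extend X F v) ψ

  Sat D X (atom α) = ∀ s → X s → Lift (suc zero) (TarskiAtom 𝔐 α s)
  Sat D X (neg α)  = ∀ s → X s → Lift (suc zero) (TarskiNegAtom 𝔐 α s)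
  Sat D X (and φ ψ) = Sat D X φ × Sat D X ψ
  Sat D X (or φ ψ)  =
    Σ[ Y ∈ (Assign M → Set) ] Σ[ Z ∈ (Assign M → Set) ]
      (∀ s → (X s → Y s ⊎ Z s) × (Y s ⊎ Z s → X s)) × Sat D Y φ × Sat D Z ψ
  Sat D X (all m v V φ) = Sat (v ∷ D) (extendAll X v) φ
  Sat D X (ex m v V φ)  =
    Σ[ F ∈ (Assign M → M → Set) ]
      Uniform m D V X F × (∀ s → X s → ∃ λ a → F s a) × Sat (v ∷ D) (extend X F v) φ
  Sat D X (gq q m v V φ) =
    Σ[ F ∈ (Assign M → M → Set) ]
      Uniform m D V X F × (∀ s → X s → gqI q M (F s)) × Sat (v ∷ D) (extend X F v) φ
  Sat D X (tq t m v V φ) = tqI t 𝔐 D X (Interp m D X v V φ)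

-- ψ ↦ ψ* : from IF(𝒬 ∪ {Q}) (symbols 'Maybe I', 'nothing' = Q) to
-- IF(𝒬)[Ê(Q)] (symbols 'I', single team quantifier symbol 'tt' = Ê(Q))

star : {Sig : Signature} {I : Set} → Form Sig (Maybe I) ⊥ → Form Sig I ⊤
star (atom α) = atom α
star (neg α)  = neg α
star (and φ ψ) = and (star φ) (star ψ)
star (or φ ψ)  = or (star φ) (star ψ)
star (all m v V φ) = all m v V (star φ)
star (ex m v V φ)  = ex m v V (star φ)
star (gq (just i) m v V φ) = gq i m v V (star φ)
star (gq nothing m v V φ)  = tq tt m v V (star φ)
star (tq () m v V φ)

module Submission where

-- The heart of the argument is a single observation about one
-- quantifier step: M,X ⊨ (Q v/V)ψ says that some uniform F : X → ℘(M)
-- with all values in Q^M makes ψ true on X[F/v], i.e. that some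
-- F ∈ [ψ]^{v,V}_{M,X} is Q-valued on X -- which is literally the
-- membership [ψ]^{v,V}_{M,X} ∈ Ê(Q)^{M,X}.
--
-- The theorem then follows by structural induction on ψ
-- (`translationPreservesSat`): every other connective is interpreted
-- identically on both sides, so each case is a congruence of ⇔ under
-- products and existential quantification over teams or choice
-- functions, with the induction hypothesis for the subformulas.

open import Defs
open import Data.List using (List; _∷_)
open import Data.Maybe using (Maybe; maybe; just; nothing)
open import Data.Empty using (⊥; ⊥-elim)
open import Data.Unit using (⊤)
open import Level using (Level)
open import Data.Product using (Σ; _×_; _,_)
open import Data.Product.Function.NonDependent.Propositional using (_×-⇔_)
open import Data.Product.Function.Dependent.Propositional using (Σ-⇔)
open import Function.Bundles using (_⇔_; mk⇔)
open import Function.Construct.Identity using (↠-id)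
open import Function.Properties.Equivalence using (refl; trans)

gqClause⇔EHat : {Sig : Signature} (Q : GQ) (𝔐 : Structure Sig) (D : List Var)
  (X : Assign (Carrier 𝔐) → Set)
  (U : (Assign (Carrier 𝔐) → Carrier 𝔐 → Set) → Set)
  (B : (Assign (Carrier 𝔐) → Carrier 𝔐 → Set) → Set₁) →
  (Σ _ λ F → U F × (∀ s → X s → Q (Carrier 𝔐) (F s)) × B F)
    ⇔ EHat Q 𝔐 D X (λ F → U F × B F)
gqClause⇔EHat Q 𝔐 D X U B = mk⇔
  (λ { (F , u , valued , b) → F , (u , b) , valued })
  (λ { (F , (u , b) , valued) → F , u , valued , b })

∃-⇔ : {a b c : Level} {A : Set a} {P : A → Set b} {P′ : A → Set c} →
  (∀ {x} → P x ⇔ P′ x) → Σ A P ⇔ Σ A P′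
∃-⇔ {A = A} = Σ-⇔ (↠-id A)

module _ (Sig : Signature) {I : Set} (𝒬 : I → GQ) (Q : GQ) (𝔐 : Structure Sig) where

  SatQ : List Var → (Assign (Carrier 𝔐) → Set) → Form Sig (Maybe I) ⊥ → Set₁
  SatQ = Sat (maybe 𝒬 Q) ⊥-elim 𝔐

  SatÊ : List Var → (Assign (Carrier 𝔐) → Set) → Form Sig I ⊤ → Set₁
  SatÊ = Sat 𝒬 (λ _ → EHat Q) 𝔐

  translationPreservesSat : ∀ D X (ψ : Form Sig (Maybe I) ⊥) →
    SatQ D X ψ ⇔ SatÊ D X (star ψ)
  translationPreservesSat D X (atom α) = refl
  translationPreservesSat D X (neg α) = refl
  translationPreservesSat D X (and φ ψ) =
    translationPreservesSat D X φ ×-⇔ translationPreservesSat D X ψ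
  translationPreservesSat D X (or φ ψ) =
    ∃-⇔ λ {Y} → ∃-⇔ λ {Z} →
      refl ×-⇔ translationPreservesSat D Y φ ×-⇔ translationPreservesSat D Z ψ
  translationPreservesSat D X (all m v V φ) =
    translationPreservesSat _ _ φ
  translationPreservesSat D X (ex m v V φ) =
    ∃-⇔ (refl ×-⇔ refl ×-⇔ translationPreservesSat _ _ φ)
  translationPreservesSat D X (gq (just i) m v V φ) =
    ∃-⇔ (refl ×-⇔ refl ×-⇔ translationPreservesSat _ _ φ)
  translationPreservesSat D X (gq nothing m v V φ) =
    trans (∃-⇔ (refl ×-⇔ refl ×-⇔ translationPreservesSat _ _ φ))
          (gqClause⇔EHat Q 𝔐 D X (Uniform m D V X)
             (λ F → SatÊ (v ∷ D) (extend X F v) (star φ)))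
  translationPreservesSat D X (tq () m v V φ)

mainTheorem4 : (Sig : Signature) {I : Set} (𝒬 : I → GQ) (Q : GQ)
    (𝔐 : Structure Sig) (D : List Var) (X : Assign (Carrier 𝔐) → Set) →
    IsTeam D X → (ψ : Form Sig (Maybe I) ⊥) → Suitable D ψ →
    Sat (maybe 𝒬 Q) ⊥-elim 𝔐 D X ψ
    ⇔ Sat 𝒬 (λ (_ : ⊤) → EHat Q) 𝔐 D X (star ψ)
mainTheorem4 Sig 𝒬 Q 𝔐 D X _ ψ _ = translationPreservesSat Sig 𝒬 Q 𝔐 D X ψ
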